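{- (1) A connected finite simple graph $G$ has the property that every connected induced subgraph of $G$ is antipodal if and only if $G$ is $P_1$ or $P_2$. (2) Every connected finite simple graph is an induced subgraph of some antipodal graph; that is, the minimal hereditary superclass of the class of antipodal graphs contains all connected graphs.
   Context: An antipode of a vertex $v$ of a connected graph is a vertex at maximum distance from $v$. A graph is antipodal if it is connected and every vertex has exactly one antipode. $P_1$ and $P_2$ denote the paths on one and two vertices. A class is hereditary if it is closed under taking induced subgraphs. -}

module Defs where

open import Data.Nat using (ℕ; zero; suc; _≤_; _<_)
open import Data.Fin using (Fin; zero; suc)
open import Data.Bool using (Bool; true; false)
open import Data.Product using (Σ; ∃; _×_; _,_)
open import Data.Sum using (_⊎_)
open import Function.Bundles using (_↔_; Inverse)
open import Function.Definitions using (Injective)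
open import Relation.Binary.PropositionalEquality using (_≡_; refl)

record Graph : Set where
  field
    n      : ℕ
    adj    : Fin n → Fin n → Bool
    sym    : ∀ i j → adj i j ≡ adj j i
    irrefl : ∀ i → adj i i ≡ false
open Graph public

data Walk (G : Graph) : Fin (n G) → Fin (n G) → ℕ → Set where
  nil  : ∀ {u} → Walk G u u zero
  cons : ∀ {u v w k} → adj G u v ≡ true → Walk G v w k → Walk G u w (suc k)

Dist : (G : Graph) → Fin (n G) → Fin (n G) → ℕ → Set
Dist G u v d = Walk G u v d × (∀ k → Walk G u v k → d ≤ k)

Connected : Graph → Set
Connected G = (0 < n G) × (∀ u v → ∃ λ k → Walk G u v k)

Antipode : (G : Graph) → Fin (n G) → Fin (n G) → Set
Antipode G v w = ∃ λ d → Dist G v w d × (∀ x e → Dist G v x e → e ≤ d)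

Antipodal : Graph → Set
Antipodal G = Connected G ×
  (∀ v → Σ (Fin (n G)) λ w → Antipode G v w × (∀ w' → Antipode G v w' → w' ≡ w))

InducedSubgraph : Graph → Graph → Set
InducedSubgraph H G =
  Σ (Fin (n H) → Fin (n G)) λ f → Injective _≡_ _≡_ f ×
    (∀ i j → adj G (f i) (f j) ≡ adj H i j)

_≅_ : Graph → Graph → Set
G ≅ H = Σ (Fin (n G) ↔ Fin (n H)) λ f →
  ∀ i j → adj H (Inverse.to f i) (Inverse.to f j) ≡ adj G i j

P₁ : Graph
P₁ = record { n = 1 ; adj = λ _ _ → false ; sym = λ _ _ → refl ; irrefl = λ _ → refl }

adj₂ : Fin 2 → Fin 2 → Bool
adj₂ zero (suc zero) = true
adj₂ (suc zero) zero = true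
adj₂ _ _ = false

adj₂-sym : ∀ i j → adj₂ i j ≡ adj₂ j i
adj₂-sym zero zero = refl
adj₂-sym zero (suc zero) = refl
adj₂-sym (suc zero) zero = refl
adj₂-sym (suc zero) (suc zero) = refl

adj₂-irrefl : ∀ i → adj₂ i i ≡ false
adj₂-irrefl zero = refl
adj₂-irrefl (suc zero) = refl

P₂ : Graph
P₂ = record { n = 2 ; adj = adj₂ ; sym = adj₂-sym ; irrefl = adj₂-irrefl }

{-# OPTIONS --safe #-}
-- A connected graph on at least three vertices contains a vertex with two distinct neighbours
-- (follow a walk out of an edge); these three vertices induce a connected graph in which the
-- centre is adjacent to both others, so both are antipodes of the centre. Conversely, every
-- connected graph on at most two vertices is antipodal, which covers the connected induced
-- subgraphs of P₁ and P₂.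
--
-- For the embedding, let F be a graph in which any two vertices have a common neighbour in the
-- complement and no two adjacent vertices have equal closed neighbourhoods. Take two copies of F
-- and join x in one copy to y in the other exactly when x ≠ y and xy is not an edge of F. Each
-- vertex is then at distance 3 from its own copy and within distance 2 of every other vertex, so
-- this graph is antipodal. Every graph G, connected or not, becomes an induced subgraph of such an
-- F by adding a pendant vertex at each vertex, a hub adjacent to all pendant vertices, and three
-- isolated vertices.
module Submission where

open import Defs
open import Data.Bool using (Bool; true; false; not; _∧_)
open import Data.Bool.Properties using (∧-zeroʳ; not-¬)
open import Data.Empty using (⊥; ⊥-elim)
open import Data.Fin using (Fin; zero; suc; _≟_)
open import Data.Fin.Properties using (injective⇒≤; nonZeroIndex; +↔⊎; *↔×; 2↔Bool)
open import Data.Nat using (ℕ; zero; suc; _+_; _*_; _≤_; _<_; z≤n; s≤s; z<s; s<s; >-nonZero⁻¹)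
open import Data.Nat.Properties using (≤-trans; <⇒≤; <⇒≱; _≤?_; ≰⇒>)
open import Data.Product using (Σ; ∃; ∃₂; _×_; _,_; proj₁; proj₂)
open import Data.Sum using (_⊎_; inj₁; inj₂; [_,_])
open import Function.Bundles using (_⇔_; mk⇔; _↔_; Inverse; Injection)
open import Function.Base using (id; _∘_)
open import Function.Properties.Inverse using (↔-refl; ↔-trans; ↔⇒↣)
open import Data.Product.Function.NonDependent.Propositional using (_×-↔_)
open import Data.Sum.Function.Propositional using (_⊎-↔_)
open import Data.Sum.Properties using (≡-dec; inj₁-injective)
open import Function.Definitions using (Injective)
open import Relation.Binary.PropositionalEquality as ≡ using (_≡_; _≢_; refl; trans; cong; cong₂; subst; subst₂)
open import Relation.Nullary using (¬_; Dec; yes; no; does; contradiction)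
open import Relation.Nullary.Decidable using (_⊎-dec_; dec-true; dec-false; does-⇔)
open import Relation.Binary.Definitions using (DecidableEquality)

private
  variable
    G : Graph

_++ʷ_ : ∀ {u v w k l} → Walk G u v k → Walk G v w l → Walk G u w (k + l)
nil ++ʷ q = q
cons e p ++ʷ q = cons e (p ++ʷ q)

walk₀⇒≡ : ∀ {u v} → Walk G u v 0 → u ≡ v
walk₀⇒≡ nil = refl

walk₁⇒adj : ∀ {u v} → Walk G u v 1 → adj G u v ≡ true
walk₁⇒adj (cons e nil) = e

walk₂⇒common-neighbour : ∀ {u v} → Walk G u v 2 → ∃ λ y → adj G u y ≡ true × adj G y v ≡ true
walk₂⇒common-neighbour (cons e (cons e′ nil)) = _ , e , e′

adj⇒≢ : ∀ {u v} → adj G u v ≡ true → u ≢ v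
adj⇒≢ {G} {u} e refl with trans (≡.sym e) (irrefl G u)
... | ()

walk-exits : {S : Fin (n G) → Set} → (∀ x → Dec (S x)) → ∀ {u v k} → Walk G u v k → S u → ¬ S v →
             ∃₂ λ x y → S x × ¬ S y × adj G x y ≡ true
walk-exits S? nil Su ¬Sv = ⊥-elim (¬Sv Su)
walk-exits S? (cons {v = w} e p) Su ¬Sv with S? w
... | yes Sw = walk-exits S? p Sw ¬Sv
... | no ¬Sw = _ , w , Su , ¬Sw , e

neighbour-towards : ∀ {u v k} → Walk G u v k → u ≢ v → ∃ λ w → adj G u w ≡ true
neighbour-towards {G} {u} p u≢v with walk-exits (λ x → x ≟ u) p refl (λ v≡u → u≢v (≡.sym v≡u))
... | .u , w , refl , _ , e = w , e

antipodal-by-map : (τ : Fin (n G) → Fin (n G)) (d : ℕ) → 0 < n G →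
                   (∀ v → Dist G v (τ v) d) →
                   (∀ v x → x ≢ τ v → ∃ λ k → k < d × Walk G v x k) →
                   Antipodal G
antipodal-by-map {G} τ d nonempty far near = (nonempty , walk) , λ v → τ v , antipode v , unique v
  where
  walk : ∀ u v → ∃ λ k → Walk G u v k
  walk u v with v ≟ τ u
  ... | yes refl = d , proj₁ (far u)
  ... | no v≢τu = let (k , _ , p) = near u v v≢τu in k , p
  antipode : ∀ v → Antipode G v (τ v)
  antipode v = d , far v , bound
    where
    bound : ∀ x e → Dist G v x e → e ≤ d
    bound x e (_ , shortest) with x ≟ τ v
    ... | yes refl = shortest d (proj₁ (far v))
    ... | no x≢τv = let (k , k<d , p) = near v x x≢τv in ≤-trans (shortest k p) (<⇒≤ k<d)
  unique : ∀ v w → Antipode G v w → w ≡ τ v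
  unique v w (e , (_ , shortest) , bound) with w ≟ τ v
  ... | yes w≡τv = w≡τv
  ... | no w≢τv = let (k , k<d , p) = near v w w≢τv in
                  ⊥-elim (<⇒≱ k<d (≤-trans (bound (τ v) d (far v)) (shortest k p)))

avoid-two : ∀ {k} (a b : Fin (3 + k)) → ∃ λ c → c ≢ a × c ≢ b
avoid-two zero          zero          = suc zero       , (λ ()) , (λ ())
avoid-two zero          (suc zero)    = suc (suc zero) , (λ ()) , (λ ())
avoid-two zero          (suc (suc _)) = suc zero       , (λ ()) , (λ ())
avoid-two (suc zero)    zero          = suc (suc zero) , (λ ()) , (λ ())
avoid-two (suc zero)    (suc zero)    = zero           , (λ ()) , (λ ())
avoid-two (suc zero)    (suc (suc _)) = zero           , (λ ()) , (λ ())
avoid-two (suc (suc _)) zero          = suc zero       , (λ ()) , (λ ())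
avoid-two (suc (suc _)) (suc zero)    = zero           , (λ ()) , (λ ())
avoid-two (suc (suc _)) (suc (suc _)) = zero           , (λ ()) , (λ ())

Dominating : (G : Graph) → Fin (n G) → Set
Dominating G v = ∀ x → x ≢ v → adj G v x ≡ true

dominating⇒connected : ∀ {v} → Dominating G v → Connected G
dominating⇒connected {G} {v} dom = >-nonZero⁻¹ _ {{nonZeroIndex v}} , λ x y → _ , (proj₂ (toward x) ++ʷ proj₂ (away y))
  where
  away : ∀ y → ∃ λ k → Walk G v y k
  away y with y ≟ v
  ... | yes refl = 0 , nil
  ... | no y≢v = 1 , cons (dom y y≢v) nil
  toward : ∀ x → ∃ λ k → Walk G x v k
  toward x with x ≟ v
  ... | yes refl = 0 , nil
  ... | no x≢v = 1 , cons (trans (Graph.sym G x v) (dom x x≢v)) nil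

dominating⇒antipode : ∀ {v w} → Dominating G v → w ≢ v → Antipode G v w
dominating⇒antipode {G} {v} {w} dom w≢v = 1 , (cons (dom w w≢v) nil , shortest) , bound
  where
  shortest : ∀ k → Walk G v w k → 1 ≤ k
  shortest zero p = ⊥-elim (w≢v (≡.sym (walk₀⇒≡ p)))
  shortest (suc k) p = s≤s z≤n
  bound : ∀ x e → Dist G v x e → e ≤ 1
  bound x e (_ , shortest-x) with x ≟ v
  ... | yes refl = ≤-trans (shortest-x 0 nil) z≤n
  ... | no x≢v = shortest-x 1 (cons (dom x x≢v) nil)

dominating⇒¬antipodal : ∀ {v w₁ w₂} → Dominating G v → w₁ ≢ v → w₂ ≢ v → w₁ ≢ w₂ → ¬ Antipodal G
dominating⇒¬antipodal dom w₁≢v w₂≢v w₁≢w₂ (_ , antipodes) =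
  let (_ , _ , unique) = antipodes _ in
  w₁≢w₂ (trans (unique _ (dominating⇒antipode dom w₁≢v)) (≡.sym (unique _ (dominating⇒antipode dom w₂≢v))))

induced : (G : Graph) {k : ℕ} → (Fin k → Fin (n G)) → Graph
induced G {k} f = record
  { n = k ; adj = λ i j → adj G (f i) (f j)
  ; sym = λ i j → Graph.sym G (f i) (f j) ; irrefl = λ i → irrefl G (f i) }

induced-subgraph : ∀ {k} {f : Fin k → Fin (n G)} → Injective _≡_ _≡_ f → InducedSubgraph (induced G f) G
induced-subgraph {f = f} f-injective = f , f-injective , λ i j → refl

induced-subgraph⇒≤ : ∀ {H} → InducedSubgraph H G → n H ≤ n G
induced-subgraph⇒≤ (_ , f-injective , _) = injective⇒≤ f-injective

≅⇒≤ : ∀ {H} → G ≅ H → n G ≤ n H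
≅⇒≤ (iso , _) = injective⇒≤ (Injection.injective (↔⇒↣ iso))

-- Hereditarily antipodal graphs

HereditarilyAntipodal : Graph → Set
HereditarilyAntipodal G = ∀ H → InducedSubgraph H G → Connected H → Antipodal H

record Cherry (G : Graph) : Set where
  field
    centre leaf₁ leaf₂ : Fin (n G)
    leaf₁≢leaf₂ : leaf₁ ≢ leaf₂
    centre-leaf₁ : adj G centre leaf₁ ≡ true
    centre-leaf₂ : adj G centre leaf₂ ≡ true

cherry⇒¬hereditarily-antipodal : Cherry G → ¬ HereditarilyAntipodal G
cherry⇒¬hereditarily-antipodal {G} cherry hereditary =
  dominating⇒¬antipodal {w₁ = suc zero} {w₂ = suc (suc zero)} dom (λ ()) (λ ()) (λ ())
    (hereditary (induced G vertex) (induced-subgraph {G} vertex-injective) (dominating⇒connected dom))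
  where
  open Cherry cherry
  vertex : Fin 3 → Fin (n G)
  vertex zero = centre
  vertex (suc zero) = leaf₁
  vertex (suc (suc zero)) = leaf₂
  centre≢leaf₁ : centre ≢ leaf₁
  centre≢leaf₁ = adj⇒≢ {G} centre-leaf₁
  centre≢leaf₂ : centre ≢ leaf₂
  centre≢leaf₂ = adj⇒≢ {G} centre-leaf₂
  vertex-injective : Injective _≡_ _≡_ vertex
  vertex-injective {zero} {zero} _ = refl
  vertex-injective {zero} {suc zero} eq = ⊥-elim (centre≢leaf₁ eq)
  vertex-injective {zero} {suc (suc zero)} eq = ⊥-elim (centre≢leaf₂ eq)
  vertex-injective {suc zero} {zero} eq = ⊥-elim (centre≢leaf₁ (≡.sym eq))
  vertex-injective {suc zero} {suc zero} _ = refl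
  vertex-injective {suc zero} {suc (suc zero)} eq = ⊥-elim (leaf₁≢leaf₂ eq)
  vertex-injective {suc (suc zero)} {zero} eq = ⊥-elim (centre≢leaf₂ (≡.sym eq))
  vertex-injective {suc (suc zero)} {suc zero} eq = ⊥-elim (leaf₁≢leaf₂ (≡.sym eq))
  vertex-injective {suc (suc zero)} {suc (suc zero)} _ = refl
  dom : Dominating (induced G vertex) zero
  dom zero 0≢0 = ⊥-elim (0≢0 refl)
  dom (suc zero) _ = centre-leaf₁
  dom (suc (suc zero)) _ = centre-leaf₂

connected⇒cherry : Connected G → 3 ≤ n G → Cherry G
connected⇒cherry {G} (_ , walk) (s≤s (s≤s (s≤s _)))
  with neighbour-towards (proj₂ (walk zero (suc zero))) (λ ())
... | b , 0-b with avoid-two zero b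
...   | c , c≢0 , c≢b
  with walk-exits (λ x → (x ≟ zero) ⊎-dec (x ≟ b)) (proj₂ (walk zero c)) (inj₁ refl) [ c≢0 , c≢b ]
... | _ , y , inj₁ refl , y∉ , 0-y = record
  { centre = zero ; leaf₁ = b ; leaf₂ = y ; leaf₁≢leaf₂ = λ b≡y → y∉ (inj₂ (≡.sym b≡y))
  ; centre-leaf₁ = 0-b ; centre-leaf₂ = 0-y }
... | _ , y , inj₂ refl , y∉ , b-y = record
  { centre = b ; leaf₁ = zero ; leaf₂ = y ; leaf₁≢leaf₂ = λ 0≡y → y∉ (inj₁ (≡.sym 0≡y))
  ; centre-leaf₁ = trans (Graph.sym G b zero) 0-b ; centre-leaf₂ = b-y }

hereditarily-antipodal⇒≤2 : Connected G → HereditarilyAntipodal G → n G ≤ 2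
hereditarily-antipodal⇒≤2 {G} connected hereditary with n G ≤? 2
... | yes n≤2 = n≤2
... | no n≰2 = ⊥-elim (cherry⇒¬hereditarily-antipodal (connected⇒cherry connected (≰⇒> n≰2)) hereditary)

pair-adjacent : ∀ {u v} → Connected G → u ≢ v → (∀ x → x ≡ u ⊎ x ≡ v) → adj G u v ≡ true
pair-adjacent {G} {u} {v} (_ , walk) u≢v cover with neighbour-towards (proj₂ (walk u v)) u≢v
... | w , u-w with cover w
...   | inj₁ refl = ⊥-elim (adj⇒≢ {G} u-w refl)
...   | inj₂ refl = u-w

other : Fin 2 → Fin 2
other zero = suc zero
other (suc zero) = zero

connected-≤2⇒antipodal : (H : Graph) → Connected H → n H ≤ 2 → Antipodal H
connected-≤2⇒antipodal record { n = zero } (() , _) _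
connected-≤2⇒antipodal record { n = suc zero } _ _ =
  antipodal-by-map id 0 (s≤s z≤n) (λ _ → nil , λ _ _ → z≤n) λ { zero zero 0≢0 → ⊥-elim (0≢0 refl) ; (suc ()) ; _ (suc ()) }
connected-≤2⇒antipodal H@record { n = suc (suc zero) } connected _ =
  antipodal-by-map other 1 (s≤s z≤n) (λ v → cons (adj-other v) nil , shortest v) near
  where
  adj-other : ∀ v → adj H v (other v) ≡ true
  adj-other zero = pair-adjacent {H} connected (λ ()) λ { zero → inj₁ refl ; (suc zero) → inj₂ refl }
  adj-other (suc zero) = pair-adjacent {H} connected (λ ()) λ { zero → inj₂ refl ; (suc zero) → inj₁ refl }
  shortest : ∀ v k → Walk H v (other v) k → 1 ≤ k
  shortest zero zero p with walk₀⇒≡ p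
  ... | ()
  shortest (suc zero) zero p with walk₀⇒≡ p
  ... | ()
  shortest _ (suc _) _ = s≤s z≤n
  near : ∀ v x → x ≢ other v → ∃ λ k → k < 1 × Walk H v x k
  near zero zero _ = 0 , s≤s z≤n , nil
  near (suc zero) (suc zero) _ = 0 , s≤s z≤n , nil
  near zero (suc zero) x≢x = ⊥-elim (x≢x refl)
  near (suc zero) zero x≢x = ⊥-elim (x≢x refl)
connected-≤2⇒antipodal record { n = suc (suc (suc _)) } _ (s≤s (s≤s ()))

connected-≤2⇒≅P₁⊎P₂ : Connected G → n G ≤ 2 → G ≅ P₁ ⊎ G ≅ P₂
connected-≤2⇒≅P₁⊎P₂ {record { n = zero }} (() , _) _
connected-≤2⇒≅P₁⊎P₂ {G@record { n = suc zero }} _ _ = inj₁ (↔-refl , λ { zero zero → ≡.sym (irrefl G zero) })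
connected-≤2⇒≅P₁⊎P₂ {G@record { n = suc (suc zero) }} connected _ = inj₂ (↔-refl , same-adj)
  where
  adj-0-1 : adj G zero (suc zero) ≡ true
  adj-0-1 = pair-adjacent {G} connected (λ ()) λ { zero → inj₁ refl ; (suc zero) → inj₂ refl }
  same-adj : ∀ i j → adj₂ i j ≡ adj G i j
  same-adj zero zero = ≡.sym (irrefl G zero)
  same-adj zero (suc zero) = ≡.sym adj-0-1
  same-adj (suc zero) zero = ≡.sym (trans (Graph.sym G (suc zero) zero) adj-0-1)
  same-adj (suc zero) (suc zero) = ≡.sym (irrefl G (suc zero))
connected-≤2⇒≅P₁⊎P₂ {record { n = suc (suc (suc _)) }} _ (s≤s (s≤s ()))

≅P₁⊎P₂⇒≤2 : G ≅ P₁ ⊎ G ≅ P₂ → n G ≤ 2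
≅P₁⊎P₂⇒≤2 {G} (inj₁ iso) = ≤-trans (≅⇒≤ {G} {P₁} iso) (s≤s z≤n)
≅P₁⊎P₂⇒≤2 {G} (inj₂ iso) = ≅⇒≤ {G} {P₂} iso

hereditarily-antipodal⇔≅P₁⊎P₂ : Connected G → HereditarilyAntipodal G ⇔ (G ≅ P₁ ⊎ G ≅ P₂)
hereditarily-antipodal⇔≅P₁⊎P₂ {G} connected = mk⇔
  (λ hereditary → connected-≤2⇒≅P₁⊎P₂ {G} connected (hereditarily-antipodal⇒≤2 {G} connected hereditary))
  (λ iso H sub connected-H →
    connected-≤2⇒antipodal H connected-H (≤-trans (induced-subgraph⇒≤ {G} {H} sub) (≅P₁⊎P₂⇒≤2 {G} iso)))

-- Embedding into an antipodal graph

does-≟-sym : ∀ {A : Set} (_≟_ : DecidableEquality A) x y → does (x ≟ y) ≡ does (y ≟ x)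
does-≟-sym _≟_ x y = does-⇔ (mk⇔ ≡.sym ≡.sym) (x ≟ y) (y ≟ x)

record SimpleGraph (V : Set) : Set where
  field
    edge        : V → V → Bool
    edge-sym    : ∀ x y → edge x y ≡ edge y x
    edge-irrefl : ∀ x → edge x x ≡ false

module _ {V : Set} {m : ℕ} (labels : Fin m ↔ V) (S : SimpleGraph V) where
  open Inverse labels
  open SimpleGraph S

  relabel : Graph
  relabel = record
    { n = m ; adj = λ i j → edge (to i) (to j)
    ; sym = λ i j → edge-sym (to i) (to j) ; irrefl = λ i → edge-irrefl (to i) }

  adj-relabel-from : ∀ i b → adj relabel i (from b) ≡ edge (to i) b
  adj-relabel-from i b = cong (edge (to i)) (strictlyInverseˡ b)

  adj-relabel : ∀ a b → adj relabel (from a) (from b) ≡ edge a b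
  adj-relabel a b = cong₂ edge (strictlyInverseˡ a) (strictlyInverseˡ b)

  relabel-walk : ∀ {i j k} → Walk relabel (from (to i)) (from (to j)) k → Walk relabel i j k
  relabel-walk {i} {j} {k} = subst₂ (λ u v → Walk relabel u v k) (strictlyInverseʳ i) (strictlyInverseʳ j)

  relabel-induced : (f : Fin (n G) → V) → Injective _≡_ _≡_ f → (∀ i j → edge (f i) (f j) ≡ adj G i j) →
                    InducedSubgraph G relabel
  relabel-induced f f-injective same-adj =
    from ∘ f , injective , λ i j → trans (adj-relabel (f i) (f j)) (same-adj i j)
    where
    injective : Injective _≡_ _≡_ (from ∘ f)
    injective {i} {j} eq =
      f-injective (trans (≡.sym (strictlyInverseˡ (f i))) (trans (cong to eq) (strictlyInverseˡ (f j))))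

module _ {V : Set} (F : SimpleGraph V) where
  open SimpleGraph F

  Coadjacent : V → V → Set
  Coadjacent x y = edge x y ≡ false × x ≢ y

  HasCommonCoNeighbours : Set
  HasCommonCoNeighbours = ∀ x y → ∃ λ z → Coadjacent x z × Coadjacent z y

  NoTrueTwins : Set
  NoTrueTwins = ∀ x y → edge x y ≡ true →
                ∃ λ r → (edge x r ≡ true × Coadjacent r y) ⊎ (Coadjacent x r × edge r y ≡ true)

  coadjacent-sym : ∀ {x y} → Coadjacent x y → Coadjacent y x
  coadjacent-sym {x} {y} (x≁y , x≢y) = trans (edge-sym y x) x≁y , λ y≡x → x≢y (≡.sym y≡x)

module Double {V : Set} (_≟_ : DecidableEquality V) (F : SimpleGraph V) where
  open SimpleGraph F

  coedge : V → V → Bool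
  coedge x y = not (edge x y) ∧ not (does (x ≟ y))

  coedge-sym : ∀ x y → coedge x y ≡ coedge y x
  coedge-sym x y = cong₂ (λ b c → not b ∧ not c) (edge-sym x y) (does-≟-sym _≟_ x y)

  coedge-irrefl : ∀ x → coedge x x ≡ false
  coedge-irrefl x rewrite dec-true (x ≟ x) refl = ∧-zeroʳ (not (edge x x))

  coadjacent⇒coedge : ∀ {x y} → Coadjacent F x y → coedge x y ≡ true
  coadjacent⇒coedge {x} {y} (x≁y , x≢y) rewrite x≁y | dec-false (x ≟ y) x≢y = refl

  coedge⇒nonadjacent : ∀ {x y} → coedge x y ≡ true → edge x y ≡ false
  coedge⇒nonadjacent {x} {y} e with edge x y
  ... | false = refl

  double-edge : V × Bool → V × Bool → Bool
  double-edge (x , false) (y , false) = edge x y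
  double-edge (x , true)  (y , true)  = edge x y
  double-edge (x , false) (y , true)  = coedge x y
  double-edge (x , true)  (y , false) = coedge x y

  double : SimpleGraph (V × Bool)
  double = record { edge = double-edge ; edge-sym = sym′ ; edge-irrefl = irrefl′ }
    where
    sym′ : ∀ a b → double-edge a b ≡ double-edge b a
    sym′ (x , false) (y , false) = edge-sym x y
    sym′ (x , true)  (y , true)  = edge-sym x y
    sym′ (x , false) (y , true)  = coedge-sym x y
    sym′ (x , true)  (y , false) = coedge-sym x y
    irrefl′ : ∀ a → double-edge a a ≡ false
    irrefl′ (x , false) = edge-irrefl x
    irrefl′ (x , true)  = edge-irrefl x

  twin : V × Bool → V × Bool
  twin (x , s) = x , not s

  same-side-edge : ∀ {x y} s → edge x y ≡ true → double-edge (x , s) (y , s) ≡ true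
  same-side-edge false e = e
  same-side-edge true  e = e

  cross-edge : ∀ {x y} s → Coadjacent F x y → double-edge (x , s) (y , not s) ≡ true
  cross-edge false c = coadjacent⇒coedge c
  cross-edge true  c = coadjacent⇒coedge c

  cross-edge′ : ∀ {x y} s → Coadjacent F x y → double-edge (x , not s) (y , s) ≡ true
  cross-edge′ false c = coadjacent⇒coedge c
  cross-edge′ true  c = coadjacent⇒coedge c

  twin-nonadjacent : ∀ a → double-edge a (twin a) ≡ false
  twin-nonadjacent (x , false) = coedge-irrefl x
  twin-nonadjacent (x , true)  = coedge-irrefl x

  edge-coedge-exclusive : ∀ {x z} → edge x z ≡ true → coedge z x ≡ true → ⊥
  edge-coedge-exclusive {x} {z} x-z z-x with trans (≡.sym x-z) (trans (edge-sym x z) (coedge⇒nonadjacent z-x))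
  ... | ()

  twins-no-common-neighbour : ∀ a c → double-edge a c ≡ true → double-edge c (twin a) ≡ true → ⊥
  twins-no-common-neighbour (x , false) (z , false) a-c c-a′ = edge-coedge-exclusive a-c c-a′
  twins-no-common-neighbour (x , true)  (z , true)  a-c c-a′ = edge-coedge-exclusive a-c c-a′
  twins-no-common-neighbour (x , false) (z , true)  a-c c-a′ = edge-coedge-exclusive c-a′ a-c
  twins-no-common-neighbour (x , true)  (z , false) a-c c-a′ = edge-coedge-exclusive c-a′ a-c

  double-labels : ∀ {m} → Fin m ↔ V → Fin (m * 2) ↔ (V × Bool)
  double-labels labels = ↔-trans *↔× (labels ×-↔ 2↔Bool)

  doubled : ∀ {m} → Fin m ↔ V → Graph
  doubled labels = relabel (double-labels labels) double

  module _ {m : ℕ} (labels : Fin m ↔ V) (co-neighbours : HasCommonCoNeighbours F) (no-twins : NoTrueTwins F) where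
    open Inverse (double-labels labels)

    Near : V × Bool → V × Bool → Set
    Near a b = ∃ λ k → k < 3 × Walk (doubled labels) (from a) (from b) k

    step : ∀ {a b} → double-edge a b ≡ true → adj (doubled labels) (from a) (from b) ≡ true
    step {a} {b} = trans (adj-relabel (double-labels labels) double a b)

    near-same : ∀ x y s → Near (x , s) (y , s)
    near-same x y s with x ≟ y
    ... | yes refl = 0 , z<s , nil
    ... | no x≢y with edge x y in x-y
    ...   | true = 1 , s<s z<s , cons (step (same-side-edge s x-y)) nil
    ...   | false with co-neighbours x y
    ...     | z , x≁z , z≁y =
      2 , s<s (s<s z<s) , cons (step (cross-edge s x≁z)) (cons (step (cross-edge′ s z≁y)) nil)

    near-cross : ∀ x y s → x ≢ y → Near (x , s) (y , not s)
    near-cross x y s x≢y with edge x y in x-y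
    ... | false = 1 , s<s z<s , cons (step (cross-edge s (x-y , x≢y))) nil
    ... | true with no-twins x y x-y
    ...   | r , inj₁ (x-r , r≁y) =
      2 , s<s (s<s z<s) , cons (step (same-side-edge s x-r)) (cons (step (cross-edge s r≁y)) nil)
    ...   | r , inj₂ (x≁r , r-y) =
      2 , s<s (s<s z<s) , cons (step (cross-edge s x≁r)) (cons (step (same-side-edge (not s) r-y)) nil)

    near : ∀ a b → b ≢ twin a → Near a b
    near (x , false) (y , false) _ = near-same x y false
    near (x , true)  (y , true)  _ = near-same x y true
    near (x , false) (y , true)  b≢a′ = near-cross x y false λ { refl → b≢a′ refl }
    near (x , true)  (y , false) b≢a′ = near-cross x y true λ { refl → b≢a′ refl }

    -- The complement of F has a triangle through every vertex: apply co-neighbours to (x, x) and then to (x, z).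
    twin-walk : ∀ a → Walk (doubled labels) (from a) (from (twin a)) 3
    twin-walk (x , s) with co-neighbours x x
    ... | z , x≁z , _ with co-neighbours x z
    ...   | z′ , x≁z′ , z′≁z =
      cons (step (cross-edge s x≁z)) (cons (step (cross-edge′ s (coadjacent-sym F z′≁z)))
        (cons (step (cross-edge s (coadjacent-sym F x≁z′))) nil))

    antipode : Fin (m * 2) → Fin (m * 2)
    antipode i = from (twin (to i))

    adj-antipode : ∀ i j → adj (doubled labels) j (antipode i) ≡ double-edge (to j) (twin (to i))
    adj-antipode i j = adj-relabel-from (double-labels labels) double j _

    antipode-far : ∀ i k → Walk (doubled labels) i (antipode i) k → 3 ≤ k
    antipode-far i zero p =
      contradiction (cong proj₂ (trans (cong to (walk₀⇒≡ p)) (strictlyInverseˡ _))) (not-¬ refl)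
    antipode-far i (suc zero) p
      with trans (≡.sym (walk₁⇒adj p)) (trans (adj-antipode i i) (twin-nonadjacent (to i)))
    ... | ()
    antipode-far i (suc (suc zero)) p with walk₂⇒common-neighbour p
    ... | y , i-y , y-i′ =
      ⊥-elim (twins-no-common-neighbour (to i) (to y) i-y (trans (≡.sym (adj-antipode i y)) y-i′))
    antipode-far i (suc (suc (suc k))) p = s≤s (s≤s (s≤s z≤n))

    doubled-antipodal : V → Antipodal (doubled labels)
    doubled-antipodal v = antipodal-by-map antipode 3 (>-nonZero⁻¹ _ {{nonZeroIndex (from (v , false))}})
      (λ i → subst (λ u → Walk (doubled labels) u (antipode i) 3) (strictlyInverseʳ i) (twin-walk (to i))
           , antipode-far i)
      near′
      where
      near′ : ∀ i j → j ≢ antipode i → ∃ λ k → k < 3 × Walk (doubled labels) i j k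
      near′ i j j≢i′ with near (to i) (to j) (λ eq → j≢i′ (trans (≡.sym (strictlyInverseʳ j)) (cong from eq)))
      ... | k , k<3 , p = k , k<3 , relabel-walk (double-labels labels) double p

module Extension (G : Graph) where
  Vertex : Set
  Vertex = Fin (n G) ⊎ Fin (n G) ⊎ Fin 4

  pattern old u      = inj₁ u
  pattern pendant u  = inj₂ (inj₁ u)
  pattern hub        = inj₂ (inj₂ zero)
  pattern isolated k = inj₂ (inj₂ (suc k))

  _≟ᵛ_ : DecidableEquality Vertex
  _≟ᵛ_ = ≡-dec _≟_ (≡-dec _≟_ _≟_)

  labels : Fin (n G + (n G + 4)) ↔ Vertex
  labels = ↔-trans +↔⊎ (↔-refl ⊎-↔ +↔⊎)

  edge : Vertex → Vertex → Bool
  edge (old u)     (old w)     = adj G u w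
  edge (old u)     (pendant w) = does (u ≟ w)
  edge (pendant u) (old w)     = does (u ≟ w)
  edge (pendant _) hub         = true
  edge hub         (pendant _) = true
  edge _           _           = false

  edge-sym : ∀ x y → edge x y ≡ edge y x
  edge-sym (old u)      (old w)      = Graph.sym G u w
  edge-sym (old u)      (pendant w)  = does-≟-sym _≟_ u w
  edge-sym (old _)      hub          = refl
  edge-sym (old _)      (isolated _) = refl
  edge-sym (pendant u)  (old w)      = does-≟-sym _≟_ u w
  edge-sym (pendant _)  (pendant _)  = refl
  edge-sym (pendant _)  hub          = refl
  edge-sym (pendant _)  (isolated _) = refl
  edge-sym hub          (old _)      = refl
  edge-sym hub          (pendant _)  = refl
  edge-sym hub          hub          = refl
  edge-sym hub          (isolated _) = refl
  edge-sym (isolated _) (old _)      = refl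
  edge-sym (isolated _) (pendant _)  = refl
  edge-sym (isolated _) hub          = refl
  edge-sym (isolated _) (isolated _) = refl

  edge-irrefl : ∀ x → edge x x ≡ false
  edge-irrefl (old u)      = irrefl G u
  edge-irrefl (pendant _)  = refl
  edge-irrefl hub          = refl
  edge-irrefl (isolated _) = refl

  extension : SimpleGraph Vertex
  extension = record { edge = edge ; edge-sym = edge-sym ; edge-irrefl = edge-irrefl }

  -- 0 is a junk value on the vertices that are not isolated.
  isolated-index : Vertex → Fin 3
  isolated-index (isolated k) = k
  isolated-index _            = zero

  extension-co-neighbours : HasCommonCoNeighbours extension
  extension-co-neighbours x y with avoid-two (isolated-index x) (isolated-index y)
  ... | k , k≢x , k≢y =
    isolated k , coadjacent-sym extension (refl , k≢x ∘ cong isolated-index) , (refl , k≢y ∘ cong isolated-index)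

  extension-no-twins : NoTrueTwins extension
  extension-no-twins (old u) (old w) u-w =
    pendant u , inj₁ (dec-true (u ≟ u) refl , dec-false (u ≟ w) (adj⇒≢ {G} u-w) , λ ())
  extension-no-twins (old u) (pendant w) _ = hub , inj₂ ((refl , λ ()) , refl)
  extension-no-twins (pendant u) (old w) _ = hub , inj₁ (refl , refl , λ ())
  extension-no-twins (pendant u) hub _ = old u , inj₁ (dec-true (u ≟ u) refl , refl , λ ())
  extension-no-twins hub (pendant u) _ = old u , inj₂ ((refl , λ ()) , dec-true (u ≟ u) refl)
  extension-no-twins (old _) hub ()
  extension-no-twins (old _) (isolated _) ()
  extension-no-twins (pendant _) (pendant _) ()
  extension-no-twins (pendant _) (isolated _) ()
  extension-no-twins hub (old _) ()
  extension-no-twins hub hub ()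
  extension-no-twins hub (isolated _) ()
  extension-no-twins (isolated _) _ ()

every-graph-is-induced-in-antipodal : (G : Graph) → Σ Graph λ H → Antipodal H × InducedSubgraph G H
every-graph-is-induced-in-antipodal G =
  doubled labels ,
  doubled-antipodal labels extension-co-neighbours extension-no-twins hub ,
  relabel-induced (double-labels labels) double {G} (λ u → old u , false) (inj₁-injective ∘ cong proj₁)
    λ _ _ → refl
  where
  open Extension G
  open Double _≟ᵛ_ extension

theorem6 : ((G : Graph) → Connected G →
    ((∀ H → InducedSubgraph H G → Connected H → Antipodal H) ⇔ (G ≅ P₁ ⊎ G ≅ P₂)))
    × ((G : Graph) → Connected G → Σ Graph λ H → Antipodal H × InducedSubgraph G H)
theorem6 = (λ G → hereditarily-antipodal⇔≅P₁⊎P₂ {G}) , λ G _ → every-graph-is-induced-in-antipodal G
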